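{- If $G$ is a ${\cal D}$ graph for the Maker-Breaker total domination game and $H$ is any graph, then the lexicographic product $G[H]$ is ${\cal D}$.
   Context: The Maker-Breaker total domination game on a graph is played by Dominator and Staller, who alternately select a vertex not selected before. Dominator wins if at some point the set of vertices he has selected is a total dominating set (every vertex has a neighbour in it); otherwise Staller wins. A graph is ${\cal D}$ if Dominator has a winning strategy both when he moves first and when Staller moves first. The lexicographic product $G[H]$ has vertex set $V(G)\times V(H)$, with $(g,h)$ adjacent to $(g',h')$ if $gg'\in E(G)$, or if $g=g'$ and $hh'\in E(H)$. -}

module Defs where

open import Data.Nat using (ℕ; _*_)
open import Data.Fin using (Fin; remQuot; _≟_)
open import Data.Fin.Subset using (Subset; _∈_; _∉_; ⁅_⁆; _∪_) renaming (⊥ to ∅)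
open import Data.Bool using (Bool; true; false; _∨_; _∧_)
open import Data.Product using (Σ; ∃; _×_; _,_)
open import Relation.Nullary.Decidable using (⌊_⌋)
open import Relation.Binary.PropositionalEquality using (_≡_; refl)
import Relation.Binary.PropositionalEquality as P
open import Relation.Nullary using (yes; no)
open import Data.Empty using (⊥-elim)

record Graph : Set where
  field
    order : ℕ
    adj   : Fin order → Fin order → Bool
    sym   : ∀ u v → adj u v ≡ adj v u
    irrefl : ∀ v → adj v v ≡ false
open Graph public

IsTotalDominating : (G : Graph) → Subset (order G) → Set
IsTotalDominating G D = ∀ v → ∃ λ u → (u ∈ D) × (adj G v u ≡ true)

Free : {n : ℕ} → Subset n → Subset n → Fin n → Set
Free D S v = (v ∉ D) × (v ∉ S)

-- D = vertices selected by Dominator,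
-- S = vertices selected by Staller. Dominator wins as soon as D is a total
-- dominating set; the game ends (Staller wins) if no vertex is left.
mutual
  data DomWinsDomTurn (G : Graph) (D S : Subset (order G)) : Set where
    done-D : IsTotalDominating G D → DomWinsDomTurn G D S
    move   : (v : Fin (order G)) → Free D S v →
             DomWinsStallTurn G (⁅ v ⁆ ∪ D) S → DomWinsDomTurn G D S

  data DomWinsStallTurn (G : Graph) (D S : Subset (order G)) : Set where
    done-S  : IsTotalDominating G D → DomWinsStallTurn G D S
    respond : (∃ λ v → Free D S v) →
              ((v : Fin (order G)) → Free D S v → DomWinsDomTurn G D (⁅ v ⁆ ∪ S)) →
              DomWinsStallTurn G D S

IsD : Graph → Set
IsD G = DomWinsDomTurn G ∅ ∅ × DomWinsStallTurn G ∅ ∅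

pairAdj : (G H : Graph) → Fin (order G) × Fin (order H) → Fin (order G) × Fin (order H) → Bool
pairAdj G H (g , h) (g' , h') = adj G g g' ∨ (⌊ g ≟ g' ⌋ ∧ adj H h h')

lexAdj : (G H : Graph) → Fin (order G * order H) → Fin (order G * order H) → Bool
lexAdj G H x y = pairAdj G H (remQuot (order H) x) (remQuot (order H) y)

private
  ≟-sym : {n : ℕ} (a b : Fin n) → ⌊ a ≟ b ⌋ ≡ ⌊ b ≟ a ⌋
  ≟-sym a b with a ≟ b | b ≟ a
  ... | yes _ | yes _ = refl
  ... | no _  | no _  = refl
  ... | yes p | no q  = ⊥-elim (q (P.sym p))
  ... | no p  | yes q = ⊥-elim (p (P.sym q))

  ≟-refl : {n : ℕ} (a : Fin n) → ⌊ a ≟ a ⌋ ≡ true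
  ≟-refl a with a ≟ a
  ... | yes _ = refl
  ... | no p  = ⊥-elim (p refl)

  lexAdj-sym : (G H : Graph) → ∀ x y → lexAdj G H x y ≡ lexAdj G H y x
  lexAdj-sym G H x y = pairAdj-sym (remQuot (order H) x) (remQuot (order H) y)
    where
    pairAdj-sym : ∀ p q → pairAdj G H p q ≡ pairAdj G H q p
    pairAdj-sym (g , h) (g' , h') rewrite sym G g g' | ≟-sym g g' | sym H h h' = refl

  lexAdj-irrefl : (G H : Graph) → ∀ x → lexAdj G H x x ≡ false
  lexAdj-irrefl G H x = pairAdj-irrefl (remQuot (order H) x)
    where
    pairAdj-irrefl : ∀ p → pairAdj G H p p ≡ false
    pairAdj-irrefl (g , h) rewrite irrefl G g | ≟-refl g | irrefl H h = refl

lex : Graph → Graph → Graph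
lex G H = record
  { order  = order G * order H
  ; adj    = lexAdj G H
  ; sym    = lexAdj-sym G H
  ; irrefl = lexAdj-irrefl G H
  }

-- Dominator plays his winning strategy for G inside the layer G × {h₀} of G[H].
-- A Staller move (g , h) is answered as if Staller had played g in G; when g is
-- already claimed, Dominator regards the move as a pass, which cannot hurt him
-- since an extra move never does. Because (g , h) ~ (g' , h') whenever g ~ g',
-- the layer copy of a total dominating set of G totally dominates G[H].
module Submission where

open import Defs
open import Data.Nat using (ℕ; zero; suc; _<_)
open import Data.Nat.Induction using (<-wellFounded)
open import Induction.WellFounded using (Acc; acc)
open import Data.Fin using (Fin; zero; remQuot; combine)
open import Data.Fin.Properties using (any?; remQuot-combine)
open import Data.Fin.Subset using (Subset; _∈_; _∉_; _⊆_; _⊂_; ⁅_⁆; _∪_; ∁; ∣_∣)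
  renaming (⊥ to ∅)
open import Data.Fin.Subset.Properties
  using (_∈?_; x∈p∪q⁺; x∈p∪q⁻; p⊆p∪q; q⊆p∪q; x∈⁅x⁆; x∈⁅y⁆⇒x≡y; ∉⊥;
         x∈p⇒x∉∁p; x∉p⇒x∈∁p; x∈∁p⇒x∉p; p⊂q⇒∣p∣<∣q∣)
open import Data.Bool using (true)
open import Data.Product using (∃; _×_; _,_; proj₁; proj₂)
open import Data.Sum using (_⊎_; inj₁; inj₂; [_,_])
import Data.Sum as Sum
open import Function using (_∘_; id)
open import Relation.Nullary using (¬_; Dec; yes; no; ¬?; _×-dec_; contradiction)
open import Relation.Binary.PropositionalEquality using (_≡_; refl; cong; subst)
  renaming (sym to ≡-sym)

private
  variable
    n : ℕ
    p q p₂ q₂ D S D₂ S₂ : Subset n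
    v : Fin n

∪-mono : p ⊆ p₂ → q ⊆ q₂ → p ∪ q ⊆ p₂ ∪ q₂
∪-mono {q = q} p⊆p₂ q⊆q₂ = x∈p∪q⁺ ∘ Sum.map p⊆p₂ q⊆q₂ ∘ x∈p∪q⁻ _ q

∈⁅⁆∪⁻ : ∀ {x} → x ∈ ⁅ v ⁆ ∪ p → x ≡ v ⊎ x ∈ p
∈⁅⁆∪⁻ {v = v} = Sum.map₁ (x∈⁅y⁆⇒x≡y v) ∘ x∈p∪q⁻ ⁅ v ⁆ _

∁-⊂ : p ⊂ q → ∁ q ⊂ ∁ p
∁-⊂ (p⊆q , x , x∈q , x∉p) =
  (λ y∈∁q → x∉p⇒x∈∁p (x∈∁p⇒x∉p y∈∁q ∘ p⊆q)) , x , x∉p⇒x∈∁p x∉p , x∈p⇒x∉∁p x∈q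

free⇒∉∪ : Free D S v → v ∉ D ∪ S
free⇒∉∪ {D = D} {S} (v∉D , v∉S) = [ v∉D , v∉S ] ∘ x∈p∪q⁻ D S

∉∪⇒free : v ∉ D ∪ S → Free D S v
∉∪⇒free v∉D∪S = v∉D∪S ∘ x∈p∪q⁺ ∘ inj₁ , v∉D∪S ∘ x∈p∪q⁺ ∘ inj₂

Fin-inhabited? : (m : ℕ) → Dec (Fin m)
Fin-inhabited? zero    = no λ ()
Fin-inhabited? (suc m) = yes zero

unclaimed : Subset n → Subset n → ℕ
unclaimed D S = ∣ ∁ (D ∪ S) ∣

claim-< : D ∪ S ⊆ D₂ ∪ S₂ → v ∉ D ∪ S → v ∈ D₂ ∪ S₂ → unclaimed D₂ S₂ < unclaimed D S
claim-< sub v∉ v∈ = p⊂q⇒∣p∣<∣q∣ (∁-⊂ (sub , _ , v∈ , v∉))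

dominatorClaim-< : Free D S v → unclaimed (⁅ v ⁆ ∪ D) S < unclaimed D S
dominatorClaim-< {D = D} {S} {v} free =
  claim-< (∪-mono (q⊆p∪q ⁅ v ⁆ D) id) (free⇒∉∪ free) (p⊆p∪q S (p⊆p∪q D (x∈⁅x⁆ v)))

stallerClaim-< : Free D S v → unclaimed D (⁅ v ⁆ ∪ S) < unclaimed D S
stallerClaim-< {D = D} {S} {v} free =
  claim-< (∪-mono id (q⊆p∪q ⁅ v ⁆ S)) (free⇒∉∪ free) (q⊆p∪q D _ (p⊆p∪q S (x∈⁅x⁆ v)))

Dominatable : (G : Graph) → Subset (order G) → Subset (order G) → Set
Dominatable G D S = ∀ v → ∃ λ u → (u ∈ D ⊎ u ∉ S) × adj G v u ≡ true

module _ {G : Graph} where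

  dominatable-⊆ : D ⊆ D₂ → Dominatable G D S → Dominatable G D₂ S
  dominatable-⊆ D⊆D₂ dom v with dom v
  ... | u , u-ok , uv = u , Sum.map₁ D⊆D₂ u-ok , uv

  dominating⇒dominatable : IsTotalDominating G D → Dominatable G D S
  dominating⇒dominatable td v with td v
  ... | u , u∈D , uv = u , inj₁ u∈D , uv

  mutual
    domTurn⇒dominatable : DomWinsDomTurn G D S → Dominatable G D S
    domTurn⇒dominatable (done-D td) = dominating⇒dominatable td
    domTurn⇒dominatable (move w (_ , w∉S) win) v
      with stallTurn⇒dominatable win v
    ... | u , inj₂ u∉S , uv = u , inj₂ u∉S , uv
    ... | u , inj₁ u∈wD , uv with ∈⁅⁆∪⁻ u∈wD
    ...   | inj₂ u∈D = u , inj₁ u∈D , uv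
    ...   | inj₁ refl = u , inj₂ w∉S , uv

    stallTurn⇒dominatable : DomWinsStallTurn G D S → Dominatable G D S
    stallTurn⇒dominatable (done-S td) = dominating⇒dominatable td
    stallTurn⇒dominatable (respond (w , free) strategy) v
      with domTurn⇒dominatable (strategy w free) v
    ... | u , inj₁ u∈D , uv = u , inj₁ u∈D , uv
    ... | u , inj₂ u∉wS , uv = u , inj₂ (u∉wS ∘ q⊆p∪q ⁅ w ⁆ _) , uv

  dominatable⇒free⊎dominating : Dominatable G D S → ∃ (Free D S) ⊎ IsTotalDominating G D
  dominatable⇒free⊎dominating {D = D} {S} dom
    with any? (λ u → ¬? (u ∈? D) ×-dec ¬? (u ∈? S))
  ... | yes free = inj₁ free
  ... | no noFree = inj₂ dominating
    where
    dominating : IsTotalDominating G D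
    dominating v with dom v
    ... | u , inj₁ u∈D , uv = u , u∈D , uv
    ... | u , inj₂ u∉S , uv with u ∈? D
    ...   | yes u∈D = u , u∈D , uv
    ...   | no u∉D = contradiction (u , u∉D , u∉S) noFree

  dominating-⊆ : D ⊆ D₂ → IsTotalDominating G D → IsTotalDominating G D₂
  dominating-⊆ D⊆D₂ td v with td v
  ... | u , u∈D , uv = u , D⊆D₂ u∈D , uv

  mutual
    domTurn-⊆ : D ⊆ D₂ → DomWinsDomTurn G D S → DomWinsDomTurn G D₂ S
    domTurn-⊆ D⊆D₂ (done-D td) = done-D (dominating-⊆ D⊆D₂ td)
    domTurn-⊆ {D₂ = D₂} D⊆D₂ (move v (_ , v∉S) win) with v ∈? D₂
    ... | yes v∈D₂ = stallTurn⇒domTurn vD⊆D₂ win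
      where
      vD⊆D₂ : ⁅ v ⁆ ∪ _ ⊆ D₂
      vD⊆D₂ u∈vD with ∈⁅⁆∪⁻ u∈vD
      ... | inj₁ refl = v∈D₂
      ... | inj₂ u∈D = D⊆D₂ u∈D
    ... | no v∉D₂ = move v (v∉D₂ , v∉S) (stallTurn-⊆ (∪-mono id D⊆D₂) win)

    stallTurn-⊆ : D ⊆ D₂ → DomWinsStallTurn G D S → DomWinsStallTurn G D₂ S
    stallTurn-⊆ D⊆D₂ (done-S td) = done-S (dominating-⊆ D⊆D₂ td)
    stallTurn-⊆ D⊆D₂ win@(respond _ strategy)
      with dominatable⇒free⊎dominating (dominatable-⊆ D⊆D₂ (stallTurn⇒dominatable win))
    ... | inj₂ td = done-S td
    ... | inj₁ free = respond free λ v (v∉D₂ , v∉S) →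
      domTurn-⊆ D⊆D₂ (strategy v (v∉D₂ ∘ D⊆D₂ , v∉S))

    stallTurn⇒domTurn : D ⊆ D₂ → DomWinsStallTurn G D S → DomWinsDomTurn G D₂ S
    stallTurn⇒domTurn D⊆D₂ win
      with dominatable⇒free⊎dominating (dominatable-⊆ D⊆D₂ (stallTurn⇒dominatable win))
    ... | inj₂ td = done-D td
    ... | inj₁ (w , free) = move w free (stallTurn-⊆ (q⊆p∪q ⁅ w ⁆ _ ∘ D⊆D₂) win)

module Lex (G H : Graph) where

  π : Fin (order (lex G H)) → Fin (order G)
  π x = proj₁ (remQuot (order H) x)

  lexAdj-π : ∀ x y → adj G (π x) (π y) ≡ true → adj (lex G H) x y ≡ true
  lexAdj-π x y = pairAdj-proj₁ (remQuot (order H) x) (remQuot (order H) y)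
    where
    pairAdj-proj₁ : ∀ a b → adj G (proj₁ a) (proj₁ b) ≡ true → pairAdj G H a b ≡ true
    pairAdj-proj₁ (g , _) (g' , _) gg' rewrite gg' = refl

  lex-dominating : {D : Subset (order G)} {D' : Subset (order (lex G H))} →
                   IsTotalDominating G D → (∀ {g} → g ∈ D → ∃ λ x → x ∈ D' × π x ≡ g) →
                   IsTotalDominating (lex G H) D'
  lex-dominating td fibre x with td (π x)
  ... | g , g∈D , πx~g with fibre g∈D
  ...   | y , y∈D' , refl = y , y∈D' , lexAdj-π x y πx~g

  lex-dominating-vacuous : ¬ Fin (order H) → (D' : Subset (order (lex G H))) →
                           IsTotalDominating (lex G H) D'
  lex-dominating-vacuous noVertex _ x =
    contradiction (proj₂ (remQuot {order G} (order H) x)) noVertex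

  module Strategy (h₀ : Fin (order H)) where

    ι : Fin (order G) → Fin (order (lex G H))
    ι g = combine g h₀

    π∘ι : ∀ g → π (ι g) ≡ g
    π∘ι g = cong proj₁ (remQuot-combine g h₀)

    record Shadow (D' S' : Subset (order (lex G H))) (D S : Subset (order G)) : Set where
      field
        ι-dom   : ∀ {g} → g ∈ D → ι g ∈ D'
        π-dom   : ∀ {x} → x ∈ D' → π x ∈ D
        π-stall : ∀ {x} → x ∈ S' → π x ∈ D ∪ S
    open Shadow

    private
      variable
        D' S' : Subset (order (lex G H))
        Dᴳ Sᴳ Sᴳ₂ : Subset (order G)

    shadow-∅ : Shadow ∅ ∅ ∅ ∅
    shadow-∅ = record { ι-dom = ∈∅-elim ; π-dom = ∈∅-elim ; π-stall = ∈∅-elim }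
      where
      ∈∅-elim : ∀ {m A} {x : Fin m} → x ∈ ∅ → A
      ∈∅-elim x∈∅ = contradiction x∈∅ ∉⊥

    shadow-dominating : Shadow D' S' Dᴳ Sᴳ → IsTotalDominating G Dᴳ →
                        IsTotalDominating (lex G H) D'
    shadow-dominating sh td = lex-dominating td λ {g} g∈D → ι g , ι-dom sh g∈D , π∘ι g

    shadow-free : Shadow D' S' Dᴳ Sᴳ → Free Dᴳ Sᴳ v → Free D' S' (ι v)
    shadow-free {v = v} sh free =
      free .proj₁ ∘ subst (_∈ _) (π∘ι v) ∘ π-dom sh ,
      free⇒∉∪ free ∘ subst (_∈ _) (π∘ι v) ∘ π-stall sh

    shadow-dominatorClaim : Shadow D' S' Dᴳ Sᴳ → Shadow (⁅ ι v ⁆ ∪ D') S' (⁅ v ⁆ ∪ Dᴳ) Sᴳ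
    shadow-dominatorClaim {v = v} sh = record
      { ι-dom   = [ (λ { refl → p⊆p∪q _ (x∈⁅x⁆ _) }) , q⊆p∪q _ _ ∘ ι-dom sh ] ∘ ∈⁅⁆∪⁻
      ; π-dom   = [ (λ { refl → p⊆p∪q _ (subst (_∈ ⁅ v ⁆) (≡-sym (π∘ι v)) (x∈⁅x⁆ v)) })
                  , q⊆p∪q _ _ ∘ π-dom sh ] ∘ ∈⁅⁆∪⁻
      ; π-stall = ∪-mono (q⊆p∪q _ _) id ∘ π-stall sh
      }

    shadow-stallerClaim : Sᴳ ⊆ Sᴳ₂ → ∀ {y} → π y ∈ Dᴳ ∪ Sᴳ₂ → Shadow D' S' Dᴳ Sᴳ →
                          Shadow D' (⁅ y ⁆ ∪ S') Dᴳ Sᴳ₂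
    shadow-stallerClaim S⊆S₂ πy∈ sh = record
      { ι-dom   = ι-dom sh
      ; π-dom   = π-dom sh
      ; π-stall = [ (λ { refl → πy∈ }) , ∪-mono id S⊆S₂ ∘ π-stall sh ] ∘ ∈⁅⁆∪⁻
      }

    -- Recursion is on the number of unclaimed vertices of G[H]: a Staller move
    -- on an already claimed fibre is answered without progress in the game on G.
    mutual
      simulate-domTurn : Shadow D' S' Dᴳ Sᴳ → Acc _<_ (unclaimed D' S') →
                         DomWinsDomTurn G Dᴳ Sᴳ → DomWinsDomTurn (lex G H) D' S'
      simulate-domTurn sh _ (done-D td) = done-D (shadow-dominating sh td)
      simulate-domTurn {D' = D'} {S'} sh (acc rs) (move v free win) =
        move (ι v) free′
          (simulate-stallTurn (shadow-dominatorClaim sh) (rs (dominatorClaim-< free′)) win)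
        where
        free′ : Free D' S' (ι v)
        free′ = shadow-free sh free

      simulate-stallTurn : Shadow D' S' Dᴳ Sᴳ → Acc _<_ (unclaimed D' S') →
                           DomWinsStallTurn G Dᴳ Sᴳ → DomWinsStallTurn (lex G H) D' S'
      simulate-stallTurn sh _ (done-S td) = done-S (shadow-dominating sh td)
      simulate-stallTurn sh wf win@(respond (v , free) _) =
        respond (ι v , shadow-free sh free) λ _ free′ → simulate-reply sh wf win free′

      simulate-reply : Shadow D' S' Dᴳ Sᴳ → Acc _<_ (unclaimed D' S') →
                       DomWinsStallTurn G Dᴳ Sᴳ → ∀ {y} → Free D' S' y →
                       DomWinsDomTurn (lex G H) D' (⁅ y ⁆ ∪ S')
      simulate-reply sh _ (done-S td) _ = done-D (shadow-dominating sh td)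
      simulate-reply {Dᴳ = Dᴳ} {Sᴳ} sh (acc rs) win@(respond _ strategy) {y} free′
        with π y ∈? Dᴳ ∪ Sᴳ
      ... | yes claimed =
        simulate-domTurn (shadow-stallerClaim id claimed sh) (rs (stallerClaim-< free′))
                         (stallTurn⇒domTurn id win)
      ... | no unclaimedᴳ =
        simulate-domTurn
          (shadow-stallerClaim (q⊆p∪q _ _) (q⊆p∪q _ _ (p⊆p∪q _ (x∈⁅x⁆ (π y)))) sh)
                         (rs (stallerClaim-< free′)) (strategy (π y) (∉∪⇒free unclaimedᴳ))

corollary2p6 : (G H : Graph) → IsD G → IsD (lex G H)
corollary2p6 G H (domFirst , stallFirst) with Fin-inhabited? (order H)
... | yes h₀ = simulate-domTurn shadow-∅ (<-wellFounded _) domFirst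
             , simulate-stallTurn shadow-∅ (<-wellFounded _) stallFirst
  where open Lex.Strategy G H h₀
... | no noVertex = done-D vacuous , done-S vacuous
  where
  vacuous : IsTotalDominating (lex G H) ∅
  vacuous = Lex.lex-dominating-vacuous G H noVertex ∅
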